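{- For every integer $n\geq1$, \[ [n]_q!\,e_n=\sum_{k}(-1)^{n-r}\frac{[n-1]_q!}{[k_1]_q[k_2]_q\cdots[k_{r-1}]_q\,([k_r]_q!)}\,[p_{n-k_1}]_q[p_{k_1-k_2}]_q\cdots[p_{k_{r-1}-k_r}]_q, \] where the sum is over all sequences of integers $k=(k_1,\dots,k_r)$ with $r\geq1$ and $n-1\geq k_1>k_2>\cdots>k_{r-1}>k_r=0$ (for $r=1$ this is the single sequence $k_1=0$).
   Context: Let $q$ be an indeterminate and $K$ a field containing $\mathbb{Q}(q)$; $\Lambda_K$ is the algebra of symmetric functions in $x_1,x_2,\dots$ over $K$, $e_n$ the elementary symmetric functions ($e_0=1$), $E(t)=\sum_{n\ge0}e_nt^n$. $[n]_q=1+q+\cdots+q^{n-1}$ ($n\ge1$), $[0]_q=0$, $[n]_q!=[1]_q\cdots[n]_q$, $[0]_q!=1$. $D_qF(t)=\frac{F(qt)-F(t)}{(q-1)t}$. The $q$-power sums $[p_n]_q\in\Lambda_K$ ($n\ge1$) are defined by $\sum_{n\geq1}[p_n]_q(-t)^{n-1}=D_qE(t)/E(t)$. -}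

module Defs where

open import Algebra.Bundles using (CommutativeRing)
open import Data.Nat using (ℕ; zero; suc; _∸_)
open import Data.List using (List; []; _∷_; _++_; map; length; foldr; [_])

-- Definitions relative to a commutative ring R (the coefficient ring,
-- e.g. Λ_K) and an element q of R.
module QDefs {c ℓ} (R : CommutativeRing c ℓ) where
  open CommutativeRing R

  qint : Carrier → ℕ → Carrier
  qint q zero    = 0#
  qint q (suc n) = 1# + q * qint q n

  qfact : Carrier → ℕ → Carrier
  qfact q zero    = 1#
  qfact q (suc n) = qint q (suc n) * qfact q n

  negpow : ℕ → Carrier
  negpow zero    = 1#
  negpow (suc m) = (- 1#) * negpow m

  sumFrom1 : (ℕ → Carrier) → ℕ → Carrier
  sumFrom1 f zero    = 0#
  sumFrom1 f (suc n) = sumFrom1 f n + f (suc n)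

  sumL : List Carrier → Carrier
  sumL = foldr _+_ 0#

  -- All strictly decreasing lists (k_1 > k_2 > ... > k_{r-1}) with entries
  -- in {1,...,m}; each such list occurs exactly once.
  chains : ℕ → List (List ℕ)
  chains zero    = [ [] ]
  chains (suc m) = chains m ++ map (suc m ∷_) (chains m)

  -- Π_i inv(k_i)   (inv m plays the role of 1/[m]_q)
  prodInv : (ℕ → Carrier) → List ℕ → Carrier
  prodInv inv []       = 1#
  prodInv inv (k ∷ ks) = inv k * prodInv inv ks

  prodP : (ℕ → Carrier) → ℕ → List ℕ → Carrier
  prodP p prev []       = 1#
  prodP p prev (k ∷ ks) = p (prev ∸ k) * prodP p k ks

  -- The summand for the sequence k = (k_1,...,k_{r-1}, k_r = 0), given by
  -- ks = (k_1,...,k_{r-1}); r = length ks + 1.  Since k_r = 0 we have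
  -- [k_r]_q! = [0]_q! = 1.
  term : Carrier → (ℕ → Carrier) → (ℕ → Carrier) → ℕ → List ℕ → Carrier
  term q inv p n ks =
    negpow (n ∸ suc (length ks)) * (qfact q (n ∸ 1) * prodInv inv ks)
      * prodP p n (ks ++ [ 0 ])

-- Newton's identity, read as the recurrence
--   [n]_q e_n = Σ_{k<n} (-1)^(n-1-k) e_k [p_(n-k)]_q,
-- determines e from e_0 = 1 because every [n]_q is invertible.  Let C_n be the
-- chain sum on the right of the theorem without the factor [n-1]_q!.  Grouping the
-- chains by their leading entry k_1 gives C_n = Σ_{k<n} (-1)^(n-1-k) ẽ_k [p_(n-k)]_q
-- with ẽ_0 = 1 and ẽ_k = C_k / [k]_q (chainSol), so ẽ solves the recurrence, e = ẽ, and
-- [n]_q! e_n = [n-1]_q! C_n.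

{-# OPTIONS --safe #-}
module Submission where

open import Defs
open import Algebra.Bundles using (CommutativeRing)
open import Data.Nat using (ℕ; zero; suc; _∸_; _≤_; _<_; z≤n; s≤s) renaming (_+_ to _+ℕ_)
open import Data.Nat.Properties
  using (+-∸-assoc; ∸-+-assoc; m∸n+n≡m; m∸[m∸n]≡n; m≤n⇒m≤1+n; m<n⇒m<1+n; n<1+n; <⇒≤)
  renaming (+-comm to +ℕ-comm)
open import Data.Nat.Induction using (<-rec)
open import Data.List using (List; []; _∷_; _++_; map; length; [_])
open import Data.List.Properties using (map-++; map-∘)
open import Function using (_∘_)
open import Relation.Binary.PropositionalEquality as ≡ using (_≡_)
import Algebra.Solver.Ring.NaturalCoefficients.Default as RingSolver
import Relation.Binary.Reasoning.Setoid as SetoidReasoning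

m∸o≡[m∸n]+[n∸o] : ∀ {m n o} → o ≤ n → n ≤ m → m ∸ o ≡ (m ∸ n) +ℕ (n ∸ o)
m∸o≡[m∸n]+[n∸o] {m} {n} {o} o≤n n≤m = begin
  m ∸ o                ≡⟨ ≡.cong (_∸ o) (≡.sym (m∸n+n≡m n≤m)) ⟩
  (m ∸ n) +ℕ n ∸ o     ≡⟨ +-∸-assoc (m ∸ n) o≤n ⟩
  (m ∸ n) +ℕ (n ∸ o)   ∎
  where open ≡.≡-Reasoning

[m∸n]∸1≡m∸[1+n] : ∀ m n → (m ∸ n) ∸ 1 ≡ m ∸ suc n
[m∸n]∸1≡m∸[1+n] m n = ≡.trans (∸-+-assoc m n 1) (≡.cong (m ∸_) (+ℕ-comm n 1))

module QDefsProperties {c ℓ} (R : CommutativeRing c ℓ) where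
  open CommutativeRing R
  open QDefs R
  open SetoidReasoning setoid

  sumL-++ : ∀ xs ys → sumL (xs ++ ys) ≈ sumL xs + sumL ys
  sumL-++ []       ys = sym (+-identityˡ _)
  sumL-++ (x ∷ xs) ys = trans (+-congˡ (sumL-++ xs ys)) (sym (+-assoc _ _ _))

  chainSum : (List ℕ → Carrier) → ℕ → Carrier
  chainSum f zero    = f []
  chainSum f (suc m) = chainSum f m + chainSum (f ∘ (suc m ∷_)) m

  sumL-map-chains : ∀ f m → sumL (map f (chains m)) ≈ chainSum f m
  sumL-map-chains f zero    = +-identityʳ (f [])
  sumL-map-chains f (suc m) = begin
    sumL (map f (chains m ++ map (suc m ∷_) (chains m)))
      ≡⟨ ≡.cong sumL (map-++ f (chains m) _) ⟩
    sumL (map f (chains m) ++ map f (map (suc m ∷_) (chains m)))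
      ≈⟨ sumL-++ (map f (chains m)) _ ⟩
    sumL (map f (chains m)) + sumL (map f (map (suc m ∷_) (chains m)))
      ≡⟨ ≡.cong (λ xs → sumL (map f (chains m)) + sumL xs) (≡.sym (map-∘ (chains m))) ⟩
    sumL (map f (chains m)) + sumL (map (f ∘ (suc m ∷_)) (chains m))
      ≈⟨ +-cong (sumL-map-chains f m) (sumL-map-chains _ m) ⟩
    chainSum f (suc m) ∎

  chainSum-cong : ∀ m {f g} → (∀ ks → length ks ≤ m → f ks ≈ g ks) → chainSum f m ≈ chainSum g m
  chainSum-cong zero    f≈g = f≈g [] z≤n
  chainSum-cong (suc m) f≈g =
    +-cong (chainSum-cong m (λ ks l → f≈g ks (m≤n⇒m≤1+n l)))
           (chainSum-cong m (λ ks l → f≈g (suc m ∷ ks) (s≤s l)))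

  *-distribˡ-chainSum : ∀ m x f → x * chainSum f m ≈ chainSum (λ ks → x * f ks) m
  *-distribˡ-chainSum zero    x f = refl
  *-distribˡ-chainSum (suc m) x f =
    trans (distribˡ x _ _) (+-cong (*-distribˡ-chainSum m x f) (*-distribˡ-chainSum m x _))

  negpow-+ : ∀ a b → negpow (a +ℕ b) ≈ negpow a * negpow b
  negpow-+ zero    b = sym (*-identityˡ _)
  negpow-+ (suc a) b = trans (*-congˡ (negpow-+ a b)) (sym (*-assoc _ _ _))

  sumBelow : (ℕ → Carrier) → ℕ → Carrier
  sumBelow h zero    = 0#
  sumBelow h (suc n) = sumBelow h n + h n

  sumBelow-cong : ∀ n {g h} → (∀ k → k < n → g k ≈ h k) → sumBelow g n ≈ sumBelow h n
  sumBelow-cong zero    g≈h = refl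
  sumBelow-cong (suc n) g≈h =
    +-cong (sumBelow-cong n (λ k k<n → g≈h k (m<n⇒m<1+n k<n))) (g≈h n (n<1+n n))

  sumBelow-suc-head : ∀ n h → sumBelow h (suc n) ≈ h 0 + sumBelow (h ∘ suc) n
  sumBelow-suc-head zero    h = trans (+-identityˡ _) (sym (+-identityʳ _))
  sumBelow-suc-head (suc n) h = trans (+-congʳ (sumBelow-suc-head n h)) (+-assoc _ _ _)

  sumFrom1-reverse : ∀ f n → sumFrom1 f n ≈ sumBelow (λ k → f (n ∸ k)) n
  sumFrom1-reverse f zero    = refl
  sumFrom1-reverse f (suc n) = begin
    sumFrom1 f n + f (suc n)                        ≈⟨ +-congʳ (sumFrom1-reverse f n) ⟩
    sumBelow (λ k → f (n ∸ k)) n + f (suc n)        ≈⟨ +-comm _ _ ⟩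
    f (suc n) + sumBelow (λ k → f (n ∸ k)) n        ≈⟨ sym (sumBelow-suc-head n (λ k → f (suc n ∸ k))) ⟩
    sumBelow (λ k → f (suc n ∸ k)) (suc n)          ∎

module Newton {c ℓ} (R : CommutativeRing c ℓ) where
  open CommutativeRing R
  open QDefs R
  open QDefsProperties R
  open RingSolver commutativeSemiring
  open SetoidReasoning setoid

  module _ (p : ℕ → Carrier) where

    newtonSum : (ℕ → Carrier) → ℕ → Carrier
    newtonSum x n = sumFrom1 (λ j → x (n ∸ j) * (negpow (j ∸ 1) * p j)) n

    newtonTerm : (ℕ → Carrier) → ℕ → ℕ → Carrier
    newtonTerm x n k = x k * (negpow (n ∸ suc k) * p (n ∸ k))

    newtonSum-reverse : ∀ x n → newtonSum x n ≈ sumBelow (newtonTerm x n) n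
    newtonSum-reverse x n = trans (sumFrom1-reverse _ n) (sumBelow-cong n reindex)
      where
      reindex : ∀ k → k < n → x (n ∸ (n ∸ k)) * (negpow ((n ∸ k) ∸ 1) * p (n ∸ k)) ≈ newtonTerm x n k
      reindex k k<n rewrite m∸[m∸n]≡n (<⇒≤ k<n) | [m∸n]∸1≡m∸[1+n] n k = refl

    newtonSum-cong : ∀ n {x y} → (∀ k → k < n → x k ≈ y k) → newtonSum x n ≈ newtonSum y n
    newtonSum-cong n {x} {y} x≈y = begin
      newtonSum x n               ≈⟨ newtonSum-reverse x n ⟩
      sumBelow (newtonTerm x n) n ≈⟨ sumBelow-cong n (λ k k<n → *-congʳ (x≈y k k<n)) ⟩
      sumBelow (newtonTerm y n) n ≈⟨ newtonSum-reverse y n ⟨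
      newtonSum y n               ∎

    SolvesNewton : Carrier → (ℕ → Carrier) → Set ℓ
    SolvesNewton q x = ∀ n → 1 ≤ n → qint q n * x n ≈ newtonSum x n

    module _ (inv : ℕ → Carrier) where

      chainTerm : ℕ → List ℕ → Carrier
      chainTerm n ks = negpow (n ∸ suc (length ks)) * prodInv inv ks * prodP p n (ks ++ [ 0 ])

      chainSol : ℕ → Carrier
      chainSol zero    = 1#
      chainSol (suc k) = inv (suc k) * chainSum (chainTerm (suc k)) k

      chainTerm-cons : ∀ {n k} ks → length ks < k → k < n →
        chainTerm n (k ∷ ks) ≈ inv k * (negpow (n ∸ suc k) * p (n ∸ k)) * chainTerm k ks
      chainTerm-cons {n} {k} ks ks<k k<n = begin
        negpow (n ∸ suc (suc l)) * (inv k * prodInv inv ks) * (p (n ∸ k) * prodP p k (ks ++ [ 0 ]))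
          ≈⟨ *-congʳ (*-congʳ negpow-split) ⟩
        negpow (n ∸ suc k) * negpow (k ∸ suc l) * (inv k * prodInv inv ks) * (p (n ∸ k) * prodP p k (ks ++ [ 0 ]))
          ≈⟨ solve 6 (λ N₁ N₂ I Π P Ρ → N₁ :* N₂ :* (I :* Π) :* (P :* Ρ) := I :* (N₁ :* P) :* (N₂ :* Π :* Ρ)) refl
               (negpow (n ∸ suc k)) (negpow (k ∸ suc l)) (inv k) (prodInv inv ks) (p (n ∸ k)) (prodP p k (ks ++ [ 0 ])) ⟩
        inv k * (negpow (n ∸ suc k) * p (n ∸ k)) * chainTerm k ks ∎
        where
        l : ℕ
        l = length ks
        negpow-split : negpow (n ∸ suc (suc l)) ≈ negpow (n ∸ suc k) * negpow (k ∸ suc l)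
        negpow-split = trans (reflexive (≡.cong negpow (m∸o≡[m∸n]+[n∸o] {o = suc (suc l)} (s≤s ks<k) k<n)))
                             (negpow-+ (n ∸ suc k) (k ∸ suc l))

      chainSum-leading≈newtonTerm : ∀ {n} k → suc k < n →
        chainSum (chainTerm n ∘ (suc k ∷_)) k ≈ newtonTerm chainSol n (suc k)
      chainSum-leading≈newtonTerm {n} k 1+k<n = begin
        chainSum (chainTerm n ∘ (suc k ∷_)) k
          ≈⟨ chainSum-cong k (λ ks l≤k → chainTerm-cons ks (s≤s l≤k) 1+k<n) ⟩
        chainSum (λ ks → a * chainTerm (suc k) ks) k
          ≈⟨ *-distribˡ-chainSum k a (chainTerm (suc k)) ⟨
        a * chainSum (chainTerm (suc k)) k
          ≈⟨ solve 4 (λ I N P S → I :* (N :* P) :* S := I :* S :* (N :* P)) refl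
               (inv (suc k)) (negpow (n ∸ suc (suc k))) (p (n ∸ suc k)) (chainSum (chainTerm (suc k)) k) ⟩
        newtonTerm chainSol n (suc k) ∎
        where
        a : Carrier
        a = inv (suc k) * (negpow (n ∸ suc (suc k)) * p (n ∸ suc k))

      chainSum≈sumBelow-newtonTerm : ∀ {n} m → m < n →
        chainSum (chainTerm n) m ≈ sumBelow (newtonTerm chainSol n) (suc m)
      chainSum≈sumBelow-newtonTerm {n} zero _ =
        solve 2 (λ N P → N :* con 1 :* (P :* con 1) := con 0 :+ con 1 :* (N :* P)) refl (negpow (n ∸ 1)) (p n)
      chainSum≈sumBelow-newtonTerm (suc m) m<n =
        +-cong (chainSum≈sumBelow-newtonTerm m (<⇒≤ m<n)) (chainSum-leading≈newtonTerm m m<n)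

      module _ (q : Carrier) (qint*inv≈1 : ∀ m → 1 ≤ m → qint q m * inv m ≈ 1#) where

        qint-inv-cancel : ∀ m y → qint q (suc m) * (inv (suc m) * y) ≈ y
        qint-inv-cancel m y = begin
          qint q (suc m) * (inv (suc m) * y) ≈⟨ *-assoc _ _ _ ⟨
          qint q (suc m) * inv (suc m) * y   ≈⟨ *-congʳ (qint*inv≈1 (suc m) (s≤s z≤n)) ⟩
          1# * y                             ≈⟨ *-identityˡ y ⟩
          y                                  ∎

        inv-qint-cancel : ∀ m y → inv (suc m) * (qint q (suc m) * y) ≈ y
        inv-qint-cancel m y =
          trans (solve 3 (λ I Q Y → I :* (Q :* Y) := Q :* (I :* Y)) refl (inv (suc m)) (qint q (suc m)) y)
                (qint-inv-cancel m y)

        chainSol-solvesNewton : SolvesNewton q chainSol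
        chainSol-solvesNewton (suc n) _ = begin
          qint q (suc n) * chainSol (suc n)                  ≈⟨ qint-inv-cancel n _ ⟩
          chainSum (chainTerm (suc n)) n                     ≈⟨ chainSum≈sumBelow-newtonTerm n (n<1+n n) ⟩
          sumBelow (newtonTerm chainSol (suc n)) (suc n)     ≈⟨ newtonSum-reverse chainSol (suc n) ⟨
          newtonSum chainSol (suc n)                         ∎

        solvesNewton-unique : ∀ {x y} → x 0 ≈ y 0 → SolvesNewton q x → SolvesNewton q y → ∀ n → x n ≈ y n
        solvesNewton-unique {x} {y} x₀≈y₀ x-solves y-solves = <-rec _ agree
          where
          agree : ∀ n → (∀ {k} → k < n → x k ≈ y k) → x n ≈ y n
          agree zero    _   = x₀≈y₀
          agree (suc n) x≈y = begin
            x (suc n)                                   ≈⟨ inv-qint-cancel n _ ⟨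
            inv (suc n) * (qint q (suc n) * x (suc n))  ≈⟨ *-congˡ (x-solves (suc n) (s≤s z≤n)) ⟩
            inv (suc n) * newtonSum x (suc n)           ≈⟨ *-congˡ (newtonSum-cong (suc n) (λ _ → x≈y)) ⟩
            inv (suc n) * newtonSum y (suc n)           ≈⟨ *-congˡ (y-solves (suc n) (s≤s z≤n)) ⟨
            inv (suc n) * (qint q (suc n) * y (suc n))  ≈⟨ inv-qint-cancel n _ ⟩
            y (suc n)                                   ∎

        qfact*chainSol≈sumL-term : ∀ n →
          qfact q (suc n) * chainSol (suc n) ≈ sumL (map (term q inv p (suc n)) (chains n))
        qfact*chainSol≈sumL-term n = begin
          qint q (suc n) * qfact q n * (inv (suc n) * S)
            ≈⟨ solve 4 (λ Q F I X → Q :* F :* (I :* X) := F :* (Q :* (I :* X))) refl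
                 (qint q (suc n)) (qfact q n) (inv (suc n)) S ⟩
          qfact q n * (qint q (suc n) * (inv (suc n) * S))
            ≈⟨ *-congˡ (qint-inv-cancel n S) ⟩
          qfact q n * S
            ≈⟨ *-distribˡ-chainSum n (qfact q n) (chainTerm (suc n)) ⟩
          chainSum (λ ks → qfact q n * chainTerm (suc n) ks) n
            ≈⟨ chainSum-cong n (λ ks _ → factorial-inside ks) ⟩
          chainSum (term q inv p (suc n)) n
            ≈⟨ sumL-map-chains (term q inv p (suc n)) n ⟨
          sumL (map (term q inv p (suc n)) (chains n)) ∎
          where
          S : Carrier
          S = chainSum (chainTerm (suc n)) n
          factorial-inside : ∀ ks → qfact q n * chainTerm (suc n) ks ≈ term q inv p (suc n) ks
          factorial-inside ks = solve 4 (λ F N Π Ρ → F :* (N :* Π :* Ρ) := N :* (F :* Π) :* Ρ) refl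
            (qfact q n) (negpow (n ∸ length ks)) (prodInv inv ks) (prodP p (suc n) (ks ++ [ 0 ]))

lemma4p1 : ∀ {c ℓ} (R : CommutativeRing c ℓ) →
    let open CommutativeRing R in
    let open QDefs R in
    (q : Carrier) (inv : ℕ → Carrier) →
    (∀ m → 1 ≤ m → qint q m * inv m ≈ 1#) →
    (e p : ℕ → Carrier) →
    e 0 ≈ 1# →
    (∀ n → 1 ≤ n → qint q n * e n ≈ sumFrom1 (λ j → e (n ∸ j) * (negpow (j ∸ 1) * p j)) n) →
    ∀ n → 1 ≤ n →
    qfact q n * e n ≈ sumL (map (term q inv p n) (chains (n ∸ 1)))
lemma4p1 R q inv qint*inv≈1 e p e₀≈1 e-solves (suc n) _ = begin
  qfact q (suc n) * e (suc n)              ≈⟨ *-congˡ (e≈chainSol (suc n)) ⟩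
  qfact q (suc n) * chainSol p inv (suc n) ≈⟨ qfact*chainSol≈sumL-term p inv q qint*inv≈1 n ⟩
  sumL (map (term q inv p (suc n)) (chains n)) ∎
  where
  open CommutativeRing R
  open QDefs R
  open Newton R
  open SetoidReasoning setoid
  e≈chainSol : ∀ m → e m ≈ chainSol p inv m
  e≈chainSol = solvesNewton-unique p inv q qint*inv≈1 e₀≈1 e-solves
                 (chainSol-solvesNewton p inv q qint*inv≈1)
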